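{- Let $L$ be a complete lattice and $\mathfrak{X}$ a relational structure of type $\tau$. Then the operations $f_i$ $(i\in I)$ of $L^{\mathfrak{X}}$, its binary join and meet operations, and its nullary bounds are finitely supported.
   Context: A type is $\tau:I\to\mathbb{N}$, $n_i=\tau(i)$; $\mathfrak{X}=(X,(R_i)_{i\in I})$ with $R_i\subseteq X^{n_i+1}$. $L^{\mathfrak{X}}$ is $L^X$ with pointwise $\wedge,\vee,0,1$ and $f_i(\alpha_1,\ldots,\alpha_{n_i})(x)=\bigvee\{\alpha_1(x_1)\wedge\cdots\wedge\alpha_{n_i}(x_{n_i}):(x_1,\ldots,x_{n_i},x)\in R_i\}$. A function $\delta\in L^X$ has finite support if $\{x:\delta(x)\neq 0\}$ is finite. An $n$-ary operation $f$ on $L^X$ is finitely supported if for all $\alpha_1,\ldots,\alpha_n\in L^X$, $f(\alpha_1,\ldots,\alpha_n)=\bigvee\{f(\delta_1,\ldots,\delta_n):\delta_k\le\alpha_k\text{ and }\delta_k\text{ has finite support for each }k\le n\}$. -}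

module Defs where

open import Level using (Level) renaming (suc to lsuc)
open import Data.Nat using (ℕ)
open import Data.Fin using (Fin; zero; suc)
open import Data.Product using (Σ; _×_; _,_)
open import Data.List using (List)
open import Data.List.Membership.Propositional using (_∈_)
open import Relation.Nullary using (¬_)
open import Relation.Binary.Lattice using (BoundedLattice)

-- For simplicity all universe levels are identified with a single ℓ.
record CompleteLattice (ℓ : Level) : Set (lsuc ℓ) where
  field
    boundedLattice : BoundedLattice ℓ ℓ ℓ
  open BoundedLattice boundedLattice public
  field
    ⋁      : {J : Set ℓ} → (J → Carrier) → Carrier
    ⋁-ub   : {J : Set ℓ} (a : J → Carrier) (j : J) → a j ≤ ⋁ a
    ⋁-least : {J : Set ℓ} (a : J → Carrier) (b : Carrier) →
              (∀ j → a j ≤ b) → ⋁ a ≤ b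

-- A type τ : I → ℕ and a relational structure 𝔛 = (X, (R_i)_{i∈I}) of type τ,
-- where R_i ⊆ X^{n_i+1}; a tuple (x_1,…,x_{n_i},x) is represented as a pair
-- (xs : Fin n_i → X, x : X).
record RelStructure (ℓ : Level) {I : Set ℓ} (τ : I → ℕ) : Set (lsuc ℓ) where
  field
    X : Set ℓ
    R : (i : I) → (Fin (τ i) → X) → X → Set ℓ

module _ {ℓ : Level} (L : CompleteLattice ℓ) where
  open CompleteLattice L

  ⋀Fin : {n : ℕ} → (Fin n → Carrier) → Carrier
  ⋀Fin {ℕ.zero}  a = ⊤
  ⋀Fin {ℕ.suc n} a = a zero ∧ ⋀Fin (λ k → a (suc k))

  module _ (X : Set ℓ) where
    Fun : Set ℓ
    Fun = X → Carrier

    _≐_ : Fun → Fun → Set ℓ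
    α ≐ β = ∀ x → α x ≈ β x

    _≤̇_ : Fun → Fun → Set ℓ
    α ≤̇ β = ∀ x → α x ≤ β x

    ⋁̇ : {J : Set ℓ} → (J → Fun) → Fun
    ⋁̇ a x = ⋁ (λ j → a j x)

    Op : ℕ → Set ℓ
    Op n = (Fin n → Fun) → Fun

    HasFiniteSupport : Fun → Set ℓ
    HasFiniteSupport δ = Σ (List X) λ xs → ∀ x → ¬ (x ∈ xs) → δ x ≈ ⊥

    FinitelySupported : {n : ℕ} → Op n → Set ℓ
    FinitelySupported {n} f =
      ∀ (α : Fin n → Fun) →
        f α ≐ ⋁̇ {J = Σ (Fin n → Fun) λ δ →
                        ∀ k → (δ k ≤̇ α k) × HasFiniteSupport (δ k)}
                 (λ p → f (Σ.proj₁ p))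

    joinOp : Op 2
    joinOp α x = α zero x ∨ α (suc zero) x

    meetOp : Op 2
    meetOp α x = α zero x ∧ α (suc zero) x

    botOp : Op 0
    botOp _ _ = ⊥

    topOp : Op 0
    topOp _ _ = ⊤

  fOp : {I : Set ℓ} {τ : I → ℕ} (𝔛 : RelStructure ℓ τ) (i : I) →
        Op (RelStructure.X 𝔛) (τ i)
  fOp {τ = τ} 𝔛 i α x =
    ⋁ {J = Σ (Fin (τ i) → X) λ xs → R i xs x} (λ p → ⋀Fin (λ k → α k (Σ.proj₁ p k)))
    where open RelStructure 𝔛

module Submission where

-- For a point x and α ∈ L^X let α↾x be α restricted to {x} (equal to
-- α x at x and ⊥ elsewhere); it lies below α and has finite support.  If f
-- is monotone, the inequality "⋁ f δ ≤ f α" over finitely supported δ ≤ α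
-- is automatic, so only "f α ≤ ⋁ f δ" needs proof.  All operations of L^𝔛
-- are *locally determined*: the value f α x is bounded by the join, over
-- choices of points ys k, of f applied to the restrictions α k ↾ ys k,
-- evaluated at x.  These restricted tuples are finitely supported
-- approximations of α, which yields the missing inequality.

open import Defs
open import Level using (Level)
open import Data.Nat using (ℕ)
open import Data.Product using (Σ; _×_; _,_; proj₁; proj₂)
open import Data.Fin using (Fin; zero; suc)
open import Data.Empty using (⊥-elim)
open import Data.List using ([_])
open import Data.List.Relation.Unary.Any using (here)
open import Data.List.Membership.Propositional using (_∈_)
open import Relation.Nullary using (¬_)
open import Relation.Binary.PropositionalEquality using (_≡_; refl)

module FiniteSupport {ℓ : Level} (L : CompleteLattice ℓ) (X : Set ℓ) where
  open CompleteLattice L renaming (refl to ≤-refl)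
  open import Relation.Binary.Lattice.Properties.JoinSemilattice joinSemilattice
    using (∨-monotonic)
  open import Relation.Binary.Lattice.Properties.MeetSemilattice meetSemilattice
    using (∧-monotonic)

  ⋀Fin-monotone : ∀ {n} (a b : Fin n → Carrier) → (∀ k → a k ≤ b k) →
                  ⋀Fin L a ≤ ⋀Fin L b
  ⋀Fin-monotone {ℕ.zero}  a b a≤b = ≤-refl
  ⋀Fin-monotone {ℕ.suc n} a b a≤b =
    ∧-monotonic (a≤b zero)
                (⋀Fin-monotone (λ k → a (suc k)) (λ k → b (suc k)) (λ k → a≤b (suc k)))

  -- α ↾ x : the restriction of α to the single point x, i.e. the join of
  -- α x over the (at most one-element) type of proofs of y ≡ x.
  _↾_ : Fun L X → X → Fun L X
  (α ↾ x) y = ⋁ {J = y ≡ x} (λ _ → α x)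

  ↾-below : ∀ α x → _≤̇_ L X (α ↾ x) α
  ↾-below α x y = ⋁-least _ _ (λ { refl → ≤-refl })

  ↾-at-point : ∀ α x → α x ≤ (α ↾ x) x
  ↾-at-point α x = ⋁-ub _ refl

  ↾-finiteSupport : ∀ α x → HasFiniteSupport L X (α ↾ x)
  ↾-finiteSupport α x = [ x ] , vanishes
    where
    vanishes : ∀ y → ¬ (y ∈ [ x ]) → (α ↾ x) y ≈ ⊥
    vanishes y y∉[x] = antisym (⋁-least _ _ (λ y≡x → ⊥-elim (y∉[x] (here y≡x))))
                               (minimum _)

  Approximation : ∀ {n} → (Fin n → Fun L X) → Set ℓ
  Approximation {n} α =
    Σ (Fin n → Fun L X) λ δ → ∀ k → _≤̇_ L X (δ k) (α k) × HasFiniteSupport L X (δ k)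

  restrictAt : ∀ {n} (ys : Fin n → X) (α : Fin n → Fun L X) → Fin n → Fun L X
  restrictAt ys α k = α k ↾ ys k

  restrictAt-approximation : ∀ {n} (ys : Fin n → X) (α : Fin n → Fun L X) →
                             Approximation α
  restrictAt-approximation ys α =
    restrictAt ys α , λ k → ↾-below (α k) (ys k) , ↾-finiteSupport (α k) (ys k)

  Monotone : ∀ {n} → Op L X n → Set ℓ
  Monotone {n} f =
    ∀ (α β : Fin n → Fun L X) → (∀ k → _≤̇_ L X (β k) (α k)) → _≤̇_ L X (f β) (f α)

  LocallyDetermined : ∀ {n} → Op L X n → Set ℓ
  LocallyDetermined {n} f =
    ∀ (α : Fin n → Fun L X) x → f α x ≤ ⋁ {J = Fin n → X} (λ ys → f (restrictAt ys α) x)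

  finitelySupported : ∀ {n} (f : Op L X n) → Monotone f → LocallyDetermined f →
                      FinitelySupported L X f
  finitelySupported f monotone local α x = antisym
    (trans (local α x)
           (⋁-least _ _ (λ ys → ⋁-ub _ (restrictAt-approximation ys α))))
    (⋁-least _ _ (λ δ → monotone α (proj₁ δ) (λ k → proj₁ (proj₂ δ k)) x))

  locally-at-point : (f : Op L X 2) →
                     (∀ α x → f α x ≤ f (restrictAt (λ _ → x) α) x) →
                     LocallyDetermined f
  locally-at-point f bound α x = trans (bound α x) (⋁-ub _ (λ _ → x))

  joinOp-finitelySupported : FinitelySupported L X (joinOp L X)
  joinOp-finitelySupported = finitelySupported (joinOp L X)
    (λ α β β≤α x → ∨-monotonic (β≤α zero x) (β≤α (suc zero) x))
    (locally-at-point (joinOp L X) λ α x →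
      ∨-monotonic (↾-at-point (α zero) x) (↾-at-point (α (suc zero)) x))

  meetOp-finitelySupported : FinitelySupported L X (meetOp L X)
  meetOp-finitelySupported = finitelySupported (meetOp L X)
    (λ α β β≤α x → ∧-monotonic (β≤α zero x) (β≤α (suc zero) x))
    (locally-at-point (meetOp L X) λ α x →
      ∧-monotonic (↾-at-point (α zero) x) (↾-at-point (α (suc zero)) x))

  -- The bounds are constant, hence trivially monotone; ⊤ is reached by the
  -- unique (empty) choice of points.
  botOp-finitelySupported : FinitelySupported L X (botOp L X)
  botOp-finitelySupported =
    finitelySupported (botOp L X) (λ _ _ _ _ → ≤-refl) (λ _ _ → minimum _)

  topOp-finitelySupported : FinitelySupported L X (topOp L X)
  topOp-finitelySupported =
    finitelySupported (topOp L X) (λ _ _ _ _ → ≤-refl) (λ _ _ → ⋁-ub _ (λ ()))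

-- The relational operations f_i: each summand ⋀ₖ α k (xs k) indexed by a
-- tuple (xs, x) ∈ R_i only reads α k at xs k, so it survives restricting
-- α k to xs k.
module RelationalOperations {ℓ : Level} (L : CompleteLattice ℓ) {I : Set ℓ}
                            {τ : I → ℕ} (𝔛 : RelStructure ℓ τ) where
  open CompleteLattice L renaming (refl to ≤-refl)
  open RelStructure 𝔛
  open FiniteSupport L X

  fOp-monotone : ∀ i → Monotone (fOp L 𝔛 i)
  fOp-monotone i α β β≤α x = ⋁-least _ _ λ p →
    trans (⋀Fin-monotone _ _ (λ k → β≤α k (proj₁ p k))) (⋁-ub _ p)

  fOp-locallyDetermined : ∀ i → LocallyDetermined (fOp L 𝔛 i)
  fOp-locallyDetermined i α x = ⋁-least _ _ λ p →
    let ys = proj₁ p in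
    trans (⋀Fin-monotone _ _ (λ k → ↾-at-point (α k) (ys k)))
          (trans (⋁-ub (λ (q : Σ (Fin (τ i) → X) λ zs → R i zs x) →
                          ⋀Fin L (λ k → restrictAt ys α k (proj₁ q k))) p)
                 (⋁-ub _ ys))

  fOp-finitelySupported : ∀ i → FinitelySupported L X (fOp L 𝔛 i)
  fOp-finitelySupported i =
    finitelySupported (fOp L 𝔛 i) (fOp-monotone i) (fOp-locallyDetermined i)

open FiniteSupport
open RelationalOperations

proposition2p10 : {ℓ : Level} (L : CompleteLattice ℓ) {I : Set ℓ} {τ : I → ℕ}
    (𝔛 : RelStructure ℓ τ) →
    let X = RelStructure.X 𝔛 in
    (∀ i → FinitelySupported L X (fOp L 𝔛 i))
    × FinitelySupported L X (joinOp L X)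
    × FinitelySupported L X (meetOp L X)
    × FinitelySupported L X (botOp L X)
    × FinitelySupported L X (topOp L X)
proposition2p10 L 𝔛 =
    fOp-finitelySupported L 𝔛
  , joinOp-finitelySupported L X
  , meetOp-finitelySupported L X
  , botOp-finitelySupported L X
  , topOp-finitelySupported L X
  where open RelStructure 𝔛 using (X)
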